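{- Let $N$ be a $k$-XOR circulant network of size $n$ with automata set $V=\{0,\ldots,n-1\}$ and global transition function $F$, and let $\widetilde{F}$ be the global transition function of its symmetric network. For any automaton $i\in V$, taking the initial configuration $x(0)=\overline{0}^i$ and $x(t)=F^t(x(0))$, it holds that $\widetilde{F}^t(x(0))=S_i(x(t))$ for all $t\in\mathbb{N}$.
   Context: For integers $k\ge 2$ and $n\ge k$, a $k$-XOR circulant network of size $n$ has automata $V=\{0,\ldots,n-1\}$, configurations $x\in\{0,1\}^n$, and an interaction matrix $\mathcal{C}$ ($n\times n$, $0/1$, $\mathcal{C}_{i,j}=1$ iff automaton $j$ influences automaton $i$) which is circulant, $\mathcal{C}_{i,j}=c_{(j-i)\bmod n}$ for some $(c_0,\ldots,c_{n-1})$, has exactly $k$ ones in each row, and satisfies $c_{n-1}=1$; the local functions are $f_i(x)=\sum_j\mathcal{C}_{i,j}x_j\bmod 2$ and under parallel updating the global transition function is $F(x)=\mathcal{C}x\bmod 2$. The symmetric network is the one with interaction matrix $\mathcal{C}^T$, with global transition function $\widetilde{F}(x)=\mathcal{C}^Tx\bmod 2$. $\overline{0}^i$ is the configuration with state $1$ at automaton $i$ and $0$ elsewhere. $S_i(x)$ is the configuration with $S_i(x)_j=x_{(2i-j)\bmod n}$ for all $j\in V$. -}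

module Defs where

open import Data.Nat using (ℕ; zero; suc; _+_; _∸_; _*_; NonZero)
open import Data.Nat.DivMod using (_%_)
open import Data.Bool using (Bool; true; false; _xor_; _∧_)
open import Data.Fin using (Fin; toℕ; fromℕ<)
open import Relation.Nullary.Decidable.Core using (isYes)
open import Data.Nat.DivMod using (m%n<n)

open import Relation.Binary.PropositionalEquality using (_≡_)
import Data.Nat
import Data.Fin

Config : ℕ → Set
Config n = Fin n → Bool

modN : (n : ℕ) → .{{_ : NonZero n}} → ℕ → Fin n
modN n m = fromℕ< (m%n<n m n)

diffMod : (n : ℕ) → .{{_ : NonZero n}} → Fin n → Fin n → Fin n
diffMod n i j = modN n (toℕ j + n ∸ toℕ i)

reflMod : (n : ℕ) → .{{_ : NonZero n}} → Fin n → Fin n → Fin n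
reflMod n i j = modN n (2 * toℕ i + n ∸ toℕ j)

countOnes : (n : ℕ) → (Fin n → Bool) → ℕ
countOnes zero c = 0
countOnes (suc n) c with c Fin.zero
... | true  = suc (countOnes n (λ j → c (Fin.suc j)))
... | false = countOnes n (λ j → c (Fin.suc j))

xorSum : (n : ℕ) → (Fin n → Bool) → Bool
xorSum zero f = false
xorSum (suc n) f = f Fin.zero xor xorSum n (λ j → f (Fin.suc j))

circ : (n : ℕ) → .{{_ : NonZero n}} → (Fin n → Bool) → Fin n → Fin n → Bool
circ n c i j = c (diffMod n i j)

F : (n : ℕ) → .{{_ : NonZero n}} → (Fin n → Bool) → Config n → Config n
F n c x i = xorSum n (λ j → circ n c i j ∧ x j)

-- Symmetric network: F~(x) = Cᵀ x mod 2.
Ft : (n : ℕ) → .{{_ : NonZero n}} → (Fin n → Bool) → Config n → Config n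
Ft n c x i = xorSum n (λ j → circ n c j i ∧ x j)

iter : {A : Set} → (A → A) → ℕ → A → A
iter f zero a = a
iter f (suc t) a = f (iter f t a)

unitConf : (n : ℕ) → Fin n → Config n
unitConf n i j = isYes (i Data.Fin.≟ j)

S : (n : ℕ) → .{{_ : NonZero n}} → Fin n → Config n → Config n
S n i x j = x (reflMod n i j)

record IsKXorCirculant (k n : ℕ) .{{_ : NonZero n}} (c : Fin n → Bool) : Set where
  field
    k≥2     : 2 Data.Nat.≤ k
    k≤n     : k Data.Nat.≤ n
    kOnes   : countOnes n c ≡ k
    lastOne : c (modN n (n ∸ 1)) ≡ true

-- The reflection ρ j = 2i − j (mod n) is an involution of ℤ/n fixing i, and it turns the
-- circulant matrix into its transpose: j − ρ m ≡ m − ρ j, so c_{j−ρm} = c_{m−ρj}.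
-- Reindexing the XOR sum by ρ therefore gives F̃ ∘ Sᵢ = Sᵢ ∘ F, and since 0̄ⁱ = Sᵢ(0̄ⁱ)
-- the claim follows by induction on t.
module Submission where

open import Defs
open import Data.Nat using (ℕ; NonZero)
open import Data.Fin using (Fin)
open import Data.Bool using (Bool)
open import Relation.Binary.PropositionalEquality using (_≡_)

open import Algebra.Bundles using (CommutativeRing)
open import Data.Bool using (_∧_; _xor_)
open import Data.Bool.Properties using (xor-∧-commutativeRing)
open import Data.Fin using (toℕ; _≟_)
open import Data.Fin.Permutation using (permutation)
open import Data.Fin.Properties using (toℕ-fromℕ<; toℕ-injective; toℕ<n)
open import Data.Nat using (zero; suc; _+_; _∸_; _*_)
open import Data.Nat.DivMod using (_%_; m%n%n≡m%n; [m+n]%n≡m%n; m<n⇒m%n≡m; %-distribˡ-+; m%n<n; m%n≤n)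
open import Data.Nat.Properties using (+-comm; +-assoc; +-identityʳ; m∸n+n≡m; m+[n∸m]≡n; m≤n⇒m≤o+n; <⇒≤)
open import Function using (_∘_)
open import Relation.Binary.PropositionalEquality using (refl; sym; trans; cong; cong₂; _≗_; module ≡-Reasoning)
open import Relation.Nullary using (yes; no; contradiction)
import Algebra.Properties.CommutativeMonoid.Sum as CommutativeMonoidSum

open ≡-Reasoning

module XorSum = CommutativeMonoidSum (CommutativeRing.+-commutativeMonoid xor-∧-commutativeRing)

xorSum≡sum : ∀ n (f : Fin n → Bool) → xorSum n f ≡ XorSum.sum f
xorSum≡sum zero    f = refl
xorSum≡sum (suc n) f = cong (f Fin.zero xor_) (xorSum≡sum n (f ∘ Fin.suc))

xorSum-cong : ∀ n {f g : Fin n → Bool} → f ≗ g → xorSum n f ≡ xorSum n g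
xorSum-cong n {f} {g} f≗g = begin
  xorSum n f    ≡⟨ xorSum≡sum n f ⟩
  XorSum.sum f  ≡⟨ XorSum.sum-cong-≗ f≗g ⟩
  XorSum.sum g  ≡⟨ xorSum≡sum n g ⟨
  xorSum n g    ∎

xorSum-reindex-involution : ∀ n {ρ : Fin n → Fin n} → (∀ m → ρ (ρ m) ≡ m) →
                            (f : Fin n → Bool) → xorSum n f ≡ xorSum n (f ∘ ρ)
xorSum-reindex-involution n {ρ} ρ-involutive f = begin
  xorSum n f          ≡⟨ xorSum≡sum n f ⟩
  XorSum.sum f        ≡⟨ XorSum.sum-permute f (permutation ρ ρ ρ-involutive ρ-involutive) ⟩
  XorSum.sum (f ∘ ρ)  ≡⟨ xorSum≡sum n (f ∘ ρ) ⟨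
  xorSum n (f ∘ ρ)    ∎

module Modular (n : ℕ) .{{_ : NonZero n}} where

  infix 4 _≈_
  _≈_ : ℕ → ℕ → Set
  a ≈ b = a % n ≡ b % n

  %-≈ : ∀ a → a % n ≈ a
  %-≈ a = m%n%n≡m%n a n

  +-congʳ : ∀ {a b} c → a ≈ b → a + c ≈ b + c
  +-congʳ {a} {b} c a≈b = begin
    (a + c) % n            ≡⟨ %-distribˡ-+ a c n ⟩
    (a % n + c % n) % n    ≡⟨ cong (λ z → (z + c % n) % n) a≈b ⟩
    (b % n + c % n) % n    ≡⟨ %-distribˡ-+ b c n ⟨
    (b + c) % n            ∎

  +-congˡ : ∀ {a b} c → a ≈ b → c + a ≈ c + b
  +-congˡ {a} {b} c a≈b = begin
    (c + a) % n  ≡⟨ cong (_% n) (+-comm c a) ⟩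
    (a + c) % n  ≡⟨ +-congʳ c a≈b ⟩
    (b + c) % n  ≡⟨ cong (_% n) (+-comm b c) ⟩
    (c + b) % n  ∎

  +-inverseʳ : ∀ a k → a + k + (n ∸ k % n) ≈ a
  +-inverseʳ a k = begin
    (a + k + (n ∸ k % n)) % n        ≡⟨ +-congʳ (n ∸ k % n) (+-congˡ a (%-≈ k)) ⟨
    (a + k % n + (n ∸ k % n)) % n    ≡⟨ cong (_% n) (+-assoc a (k % n) (n ∸ k % n)) ⟩
    (a + (k % n + (n ∸ k % n))) % n  ≡⟨ cong (λ z → (a + z) % n) (m+[n∸m]≡n (m%n≤n k n)) ⟩
    (a + n) % n                      ≡⟨ [m+n]%n≡m%n a n ⟩
    a % n                            ∎

  +-cancelʳ : ∀ a b k → a + k ≈ b + k → a ≈ b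
  +-cancelʳ a b k a+k≈b+k = begin
    a % n                      ≡⟨ +-inverseʳ a k ⟨
    (a + k + (n ∸ k % n)) % n  ≡⟨ +-congʳ (n ∸ k % n) a+k≈b+k ⟩
    (b + k + (n ∸ k % n)) % n  ≡⟨ +-inverseʳ b k ⟩
    b % n                      ∎

  toℕ-injective-≈ : {u v : Fin n} → toℕ u ≈ toℕ v → u ≡ v
  toℕ-injective-≈ {u} {v} u≈v = toℕ-injective (begin
    toℕ u      ≡⟨ m<n⇒m%n≡m (toℕ<n u) ⟨
    toℕ u % n  ≡⟨ u≈v ⟩
    toℕ v % n  ≡⟨ m<n⇒m%n≡m (toℕ<n v) ⟩
    toℕ v      ∎)

  -- Both diffMod and reflMod are of the shape modN n (y + n ∸ x): a subtraction modulo n.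
  modN-∸-+ : ∀ y (x : Fin n) → toℕ (modN n (y + n ∸ toℕ x)) + toℕ x ≈ y
  modN-∸-+ y x = begin
    (toℕ (modN n (y + n ∸ toℕ x)) + toℕ x) % n  ≡⟨ cong (λ z → (z + toℕ x) % n) (toℕ-fromℕ< (m%n<n (y + n ∸ toℕ x) n)) ⟩
    ((y + n ∸ toℕ x) % n + toℕ x) % n           ≡⟨ +-congʳ (toℕ x) (%-≈ (y + n ∸ toℕ x)) ⟩
    (y + n ∸ toℕ x + toℕ x) % n                 ≡⟨ cong (_% n) (m∸n+n≡m (m≤n⇒m≤o+n y (<⇒≤ (toℕ<n x)))) ⟩
    (y + n) % n                                 ≡⟨ [m+n]%n≡m%n y n ⟩
    y % n                                       ∎

  module Reflection (i : Fin n) where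

    ρ : Fin n → Fin n
    ρ = reflMod n i

    ρ-+ : ∀ j → toℕ (ρ j) + toℕ j ≈ 2 * toℕ i
    ρ-+ j = modN-∸-+ (2 * toℕ i) j

    ρ-involutive : ∀ j → ρ (ρ j) ≡ j
    ρ-involutive j = toℕ-injective-≈ (+-cancelʳ _ _ (toℕ (ρ j)) (begin
      (toℕ (ρ (ρ j)) + toℕ (ρ j)) % n  ≡⟨ ρ-+ (ρ j) ⟩
      (2 * toℕ i) % n                  ≡⟨ ρ-+ j ⟨
      (toℕ (ρ j) + toℕ j) % n          ≡⟨ cong (_% n) (+-comm (toℕ (ρ j)) (toℕ j)) ⟩
      (toℕ j + toℕ (ρ j)) % n          ∎))

    ρ-fixes-centre : ρ i ≡ i
    ρ-fixes-centre = toℕ-injective-≈ (+-cancelʳ _ _ (toℕ i) (begin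
      (toℕ (ρ i) + toℕ i) % n  ≡⟨ ρ-+ i ⟩
      (2 * toℕ i) % n          ≡⟨ cong (λ z → (toℕ i + z) % n) (+-identityʳ (toℕ i)) ⟩
      (toℕ i + toℕ i) % n      ∎))

    diffMod-ρ-+ : ∀ m j → toℕ (diffMod n (ρ m) j) + toℕ (ρ m) + toℕ (ρ j) ≈ 2 * toℕ i
    diffMod-ρ-+ m j = begin
      (toℕ (diffMod n (ρ m) j) + toℕ (ρ m) + toℕ (ρ j)) % n  ≡⟨ +-congʳ (toℕ (ρ j)) (modN-∸-+ (toℕ j) (ρ m)) ⟩
      (toℕ j + toℕ (ρ j)) % n                               ≡⟨ cong (_% n) (+-comm (toℕ j) (toℕ (ρ j))) ⟩
      (toℕ (ρ j) + toℕ j) % n                               ≡⟨ ρ-+ j ⟩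
      (2 * toℕ i) % n                                       ∎

    diffMod-ρ-swap : ∀ m j → diffMod n (ρ m) j ≡ diffMod n (ρ j) m
    diffMod-ρ-swap m j = toℕ-injective-≈ (+-cancelʳ _ _ (toℕ (ρ m) + toℕ (ρ j)) (begin
      (d₁ + (toℕ (ρ m) + toℕ (ρ j))) % n  ≡⟨ cong (_% n) (+-assoc d₁ (toℕ (ρ m)) (toℕ (ρ j))) ⟨
      (d₁ + toℕ (ρ m) + toℕ (ρ j)) % n    ≡⟨ diffMod-ρ-+ m j ⟩
      (2 * toℕ i) % n                     ≡⟨ diffMod-ρ-+ j m ⟨
      (d₂ + toℕ (ρ j) + toℕ (ρ m)) % n    ≡⟨ cong (_% n) (+-assoc d₂ (toℕ (ρ j)) (toℕ (ρ m))) ⟩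
      (d₂ + (toℕ (ρ j) + toℕ (ρ m))) % n  ≡⟨ cong (λ z → (d₂ + z) % n) (+-comm (toℕ (ρ j)) (toℕ (ρ m))) ⟩
      (d₂ + (toℕ (ρ m) + toℕ (ρ j))) % n  ∎))
      where
      d₁ d₂ : ℕ
      d₁ = toℕ (diffMod n (ρ m) j)
      d₂ = toℕ (diffMod n (ρ j) m)

    unitConf-ρ-invariant : unitConf n i ≗ unitConf n i ∘ ρ
    unitConf-ρ-invariant j with i ≟ j | i ≟ ρ j
    ... | yes _    | yes _    = refl
    ... | no _     | no _     = refl
    ... | yes refl | no i≢ρi  = contradiction (sym ρ-fixes-centre) i≢ρi
    ... | no i≢j   | yes i≡ρj = contradiction (begin
      i        ≡⟨ ρ-fixes-centre ⟨
      ρ i      ≡⟨ cong ρ i≡ρj ⟩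
      ρ (ρ j)  ≡⟨ ρ-involutive j ⟩
      j        ∎) i≢j

Ft-cong : ∀ n .{{_ : NonZero n}} c {x y : Config n} → x ≗ y → Ft n c x ≗ Ft n c y
Ft-cong n c x≗y j = xorSum-cong n (λ m → cong (circ n c m j ∧_) (x≗y m))

Ft∘S≗S∘F : ∀ n .{{_ : NonZero n}} c i (x : Config n) → Ft n c (S n i x) ≗ S n i (F n c x)
Ft∘S≗S∘F n c i x j = begin
  xorSum n (λ m → c (diffMod n m j) ∧ x (ρ m))          ≡⟨ xorSum-reindex-involution n {ρ} ρ-involutive _ ⟩
  xorSum n (λ m → c (diffMod n (ρ m) j) ∧ x (ρ (ρ m)))  ≡⟨ xorSum-cong n (λ m → cong₂ _∧_ (cong c (diffMod-ρ-swap m j)) (cong x (ρ-involutive m))) ⟩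
  xorSum n (λ m → c (diffMod n (ρ j) m) ∧ x m)          ∎
  where open Modular.Reflection n i

iter-intertwine : {X A : Set} {f g h : (X → A) → X → A} →
                  (∀ {x y} → x ≗ y → g x ≗ g y) → (∀ x → g (h x) ≗ h (f x)) →
                  ∀ t {x y} → y ≗ h x → iter g t y ≗ h (iter f t x)
iter-intertwine g-cong g∘h≗h∘f zero    y≗hx = y≗hx
iter-intertwine {f = f} g-cong g∘h≗h∘f (suc t) {x} y≗hx j =
  trans (g-cong (iter-intertwine g-cong g∘h≗h∘f t y≗hx) j) (g∘h≗h∘f (iter f t x) j)

proposition3 : (k n : ℕ) .{{_ : NonZero n}} (c : Fin n → Bool) → IsKXorCirculant k n c → (i : Fin n) (t : ℕ) → (j : Fin n) → iter (Ft n c) t (unitConf n i) j ≡ S n i (iter (F n c) t (unitConf n i)) j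
proposition3 k n c _ i t =
  iter-intertwine {f = F n c} {h = S n i} (Ft-cong n c) (Ft∘S≗S∘F n c i) t (Modular.Reflection.unitConf-ρ-invariant n i)
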